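{- Let $n, k \in \mathbb{N}^+$ with $\frac{n}{2} < k < n$. Then $$B_{n,k} = (n-k+3)\,2^{n-k-2}.$$
   Context: For $n,k\in\mathbb{N}^+$, $B_{n,k}$ denotes the number of ways to split $n$ indistinguishable balls into any number of nonempty, ordered (linearly arranged) bins so that the most crowded bin contains exactly $k$ balls; equivalently, the number of compositions $(x_1,\dots,x_\ell)$ of $n$ (ordered tuples of positive integers of any length $\ell\ge 1$ summing to $n$) with $\max_i x_i = k$. -}

module Defs where

open import Data.Nat using (ℕ; zero; suc; _+_; _≟_; _⊔_)
open import Data.Nat.ListAction using (sum)
open import Data.List using (List; []; _∷_; length; map; concatMap; filter; foldr; applyUpTo)
open import Data.List.Relation.Unary.All using (All)
open import Data.Nat using (_<_; _≤_)

maxList : List ℕ → ℕ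
maxList = foldr _⊔_ 0

listsOf : ℕ → ℕ → List (List ℕ)
listsOf n zero    = [] ∷ []
listsOf n (suc ℓ) = concatMap (λ x → map (x ∷_) (listsOf n ℓ)) (applyUpTo suc n)

-- all lists of positive integers in {1,…,n} of length 1 … n
-- (every composition of n has length ≤ n and parts ≤ n)
candidates : ℕ → List (List ℕ)
candidates n = concatMap (listsOf n) (applyUpTo suc n)

compositions : ℕ → List (List ℕ)
compositions n = filter (λ xs → sum xs ≟ n) (candidates n)

B : ℕ → ℕ → ℕ
B n k = length (filter (λ xs → maxList xs ≟ k) (compositions n))

-- Peel off the first part a of a composition of n = k + d with maximum k, d < k.  If a < k the
-- rest is again a composition with maximum k, of n - a; such rests exist only for a ≤ d, since
-- the maximum never exceeds the sum.  If a = k the rest is an arbitrary composition of d < k,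
-- and a > k is impossible.  Hence, with W d = B (k + d) k and c r = 2 ^ (r - 1) (c 0 = 1) the
-- number of compositions of r,
--   W d = W (d - 1) + … + W 0 + c d,
-- and the closed form 4 · W d = (d + 3) · 2 ^ d (d ≥ 1) follows by induction on d.
module Submission where

open import Defs
open import Data.Nat
  using (ℕ; zero; suc; _+_; _*_; _∸_; _^_; _⊔_; _<_; _≤_; _≟_; z≤n; s≤s; z<s; s<s; >-nonZero)
open import Data.Nat.Properties
open import Data.Nat.ListAction using (sum)
open import Data.Nat.Tactic.RingSolver using (solve-∀)
open import Algebra.Properties.CommutativeSemigroup +-commutativeSemigroup using (interchange)
open import Data.List using (List; []; _∷_; _++_; map; concatMap; applyUpTo; filter; length)
open import Data.List.Properties using (length-++; filter-++; filter-≐; filter-none)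
open import Data.List.Relation.Unary.All using (universal)
open import Data.Product using (_,_; proj₁; proj₂)
open import Data.Sum using ([_,_])
open import Function using (_∘_)
open import Level using (Level; 0ℓ)
open import Relation.Nullary using (¬_; yes; no; contradiction)
open import Relation.Unary using (Pred; Decidable; _≐_; _∩_)
open import Relation.Unary.Properties using (_∩?_)
open import Relation.Binary.PropositionalEquality
  using (_≡_; refl; sym; trans; cong; cong₂; subst; module ≡-Reasoning)

∑< : ℕ → (ℕ → ℕ) → ℕ
∑< zero    f = 0
∑< (suc n) f = f 0 + ∑< n (λ i → f (suc i))

syntax ∑< n (λ i → e) = ∑[ i < n ] e

∑-cong : ∀ n {f g : ℕ → ℕ} → (∀ {i} → i < n → f i ≡ g i) → ∑< n f ≡ ∑< n g
∑-cong zero    f≗g = refl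
∑-cong (suc n) f≗g = cong₂ _+_ (f≗g z<s) (∑-cong n (f≗g ∘ s<s))

∑-zero : ∀ n → ∑[ i < n ] 0 ≡ 0
∑-zero zero    = refl
∑-zero (suc n) = ∑-zero n

∑-distrib-+ : ∀ n (f g : ℕ → ℕ) → ∑[ i < n ] (f i + g i) ≡ ∑< n f + ∑< n g
∑-distrib-+ zero    f g = refl
∑-distrib-+ (suc n) f g = begin
  f 0 + g 0 + ∑[ i < n ] (f (suc i) + g (suc i))  ≡⟨ cong (f 0 + g 0 +_) (∑-distrib-+ n _ _) ⟩
  f 0 + g 0 + (F + G)                              ≡⟨ interchange (f 0) (g 0) F G ⟩
  f 0 + F + (g 0 + G)                              ∎
  where
  open ≡-Reasoning
  F = ∑[ i < n ] f (suc i)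
  G = ∑[ i < n ] g (suc i)

∑-distribˡ-* : ∀ n a (f : ℕ → ℕ) → a * ∑< n f ≡ ∑[ i < n ] (a * f i)
∑-distribˡ-* zero    a f = *-zeroʳ a
∑-distribˡ-* (suc n) a f =
  trans (*-distribˡ-+ a (f 0) _) (cong (a * f 0 +_) (∑-distribˡ-* n a (f ∘ suc)))

∑-comm : ∀ n m (f : ℕ → ℕ → ℕ) → ∑[ i < n ] ∑[ j < m ] f i j ≡ ∑[ j < m ] ∑[ i < n ] f i j
∑-comm zero    m f = sym (∑-zero m)
∑-comm (suc n) m f = begin
  ∑[ j < m ] f 0 j + ∑[ i < n ] ∑[ j < m ] f (suc i) j  ≡⟨ cong (∑[ j < m ] f 0 j +_) (∑-comm n m (f ∘ suc)) ⟩
  ∑[ j < m ] f 0 j + ∑[ j < m ] ∑[ i < n ] f (suc i) j  ≡⟨ ∑-distrib-+ m _ _ ⟨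
  ∑[ j < m ] (f 0 j + ∑[ i < n ] f (suc i) j)           ∎
  where open ≡-Reasoning

∑-suc : ∀ n (f : ℕ → ℕ) → ∑< (suc n) f ≡ ∑< n f + f n
∑-suc zero    f = +-comm (f 0) 0
∑-suc (suc n) f = trans (cong (f 0 +_) (∑-suc n (f ∘ suc))) (sym (+-assoc (f 0) _ _))

∑-truncate : ∀ {n r} {f : ℕ → ℕ} → r ≤ n → (∀ {i} → r ≤ i → i < n → f i ≡ 0) → ∑< n f ≡ ∑< r f
∑-truncate {n} {zero}  z≤n     f≡0 = trans (∑-cong n (f≡0 z≤n)) (∑-zero n)
∑-truncate {suc n} {suc r} (s≤s r≤n) f≡0 =
  cong (_ +_) (∑-truncate r≤n (λ r≤i i<n → f≡0 (s≤s r≤i) (s<s i<n)))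

count : {a p : Level} {A : Set a} {P : Pred A p} → Decidable P → List A → ℕ
count P? = length ∘ filter P?

module _ {a p : Level} {A : Set a} {P : Pred A p} {P? : Decidable P} where

  count-none : (∀ x → ¬ P x) → ∀ xs → count P? xs ≡ 0
  count-none ¬P xs = cong length (filter-none P? (universal ¬P xs))

  count-++ : ∀ xs ys → count P? (xs ++ ys) ≡ count P? xs + count P? ys
  count-++ xs ys = trans (cong length (filter-++ P? xs ys)) (length-++ (filter P? xs))

  count-≐ : {Q : Pred A p} {Q? : Decidable Q} → P ≐ Q → ∀ xs → count P? xs ≡ count Q? xs
  count-≐ {Q? = Q?} P≐Q xs = cong length (filter-≐ P? Q? P≐Q xs)

  count-filter : {Q : Pred A p} (Q? : Decidable Q) → ∀ xs →
    count Q? (filter P? xs) ≡ count (P? ∩? Q?) xs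
  count-filter Q? []       = refl
  count-filter Q? (x ∷ xs) with P? x
  ... | no _ = count-filter Q? xs
  ... | yes _ with Q? x
  ...   | yes _ = cong suc (count-filter Q? xs)
  ...   | no _  = count-filter Q? xs

  module _ {c : Level} {C : Set c} where

    count-map : (f : C → A) → ∀ xs → count P? (map f xs) ≡ count (λ x → P? (f x)) xs
    count-map f []       = refl
    count-map f (x ∷ xs) with P? (f x)
    ... | yes _ = cong suc (count-map f xs)
    ... | no _  = count-map f xs

    count-concatMap : (f : C → List A) → ∀ xs →
      count P? (concatMap f xs) ≡ sum (map (count P? ∘ f) xs)
    count-concatMap f []       = refl
    count-concatMap f (x ∷ xs) =
      trans (count-++ (f x) (concatMap f xs)) (cong (count P? (f x) +_) (count-concatMap f xs))

sum-map-applyUpTo : ∀ (g f : ℕ → ℕ) n → sum (map g (applyUpTo f n)) ≡ ∑[ i < n ] g (f i)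
sum-map-applyUpTo g f zero    = refl
sum-map-applyUpTo g f (suc n) = cong (g (f 0) +_) (sum-map-applyUpTo g (f ∘ suc) n)

module _ {p : Level} {P : Pred (List ℕ) p} (P? : Decidable P) where

  count-listsOf-suc : ∀ N ℓ →
    count P? (listsOf N (suc ℓ)) ≡ ∑[ i < N ] count (λ xs → P? (suc i ∷ xs)) (listsOf N ℓ)
  count-listsOf-suc N ℓ = begin
    count P? (concatMap (λ x → map (x ∷_) (listsOf N ℓ)) (applyUpTo suc N))
      ≡⟨ count-concatMap _ (applyUpTo suc N) ⟩
    sum (map (λ x → count P? (map (x ∷_) (listsOf N ℓ))) (applyUpTo suc N))
      ≡⟨ sum-map-applyUpTo _ suc N ⟩
    ∑[ i < N ] count P? (map (suc i ∷_) (listsOf N ℓ))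
      ≡⟨ ∑-cong N (λ {i} _ → count-map (suc i ∷_) (listsOf N ℓ)) ⟩
    ∑[ i < N ] count (λ xs → P? (suc i ∷ xs)) (listsOf N ℓ)
      ∎
    where open ≡-Reasoning

  count-candidates : ∀ n → count P? (candidates n) ≡ ∑[ ℓ < n ] count P? (listsOf n (suc ℓ))
  count-candidates n =
    trans (count-concatMap (listsOf n) (applyUpTo suc n)) (sum-map-applyUpTo _ suc n)

HasSum : ℕ → Pred (List ℕ) 0ℓ
HasSum r xs = sum xs ≡ r

HasMax : ℕ → Pred (List ℕ) 0ℓ
HasMax k xs = maxList xs ≡ k

HasSumMax : ℕ → ℕ → Pred (List ℕ) 0ℓ
HasSumMax r k = HasSum r ∩ HasMax k

hasSum? : ∀ r → Decidable (HasSum r)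
hasSum? r xs = sum xs ≟ r

hasMax? : ∀ k → Decidable (HasMax k)
hasMax? k xs = maxList xs ≟ k

hasSumMax? : ∀ r k → Decidable (HasSumMax r k)
hasSumMax? r k = hasSum? r ∩? hasMax? k

maxList≤sum : ∀ xs → maxList xs ≤ sum xs
maxList≤sum []       = z≤n
maxList≤sum (x ∷ xs) = ⊔-lub (m≤m+n x (sum xs)) (≤-trans (maxList≤sum xs) (m≤n+m (sum xs) x))

¬HasSumMax-sum<max : ∀ {r k} → r < k → ∀ xs → ¬ HasSumMax r k xs
¬HasSumMax-sum<max r<k xs (refl , refl) = <⇒≱ r<k (maxList≤sum xs)

HasSum-∷ : ∀ {a r} → a ≤ r → (λ xs → HasSum r (a ∷ xs)) ≐ HasSum (r ∸ a)
HasSum-∷ {a} a≤r =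
  (λ {xs} a+s≡r → trans (sym (m+n∸m≡n a (sum xs))) (cong (_∸ a) a+s≡r)) ,
  (λ s≡r∸a → trans (cong (a +_) s≡r∸a) (m+[n∸m]≡n a≤r))

¬HasSum-∷ : ∀ {a r} → r < a → ∀ xs → ¬ HasSum r (a ∷ xs)
¬HasSum-∷ {a} r<a xs a+s≡r = <⇒≱ r<a (subst (a ≤_) a+s≡r (m≤m+n a (sum xs)))

HasMax-∷ : ∀ {a k} → a < k → (λ xs → HasMax k (a ∷ xs)) ≐ HasMax k
HasMax-∷ {a} {k} a<k = (λ {xs} → to xs) , from
  where
  to : ∀ xs → a ⊔ maxList xs ≡ k → maxList xs ≡ k
  to xs a⊔m≡k = [ (λ a⊔m≡a → contradiction (trans (sym a⊔m≡a) a⊔m≡k) (<⇒≢ a<k))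
                , (λ a⊔m≡m → trans (sym a⊔m≡m) a⊔m≡k)
                ] (⊔-sel a (maxList xs))
  from : ∀ {m} → m ≡ k → a ⊔ m ≡ k
  from refl = m≤n⇒m⊔n≡n (<⇒≤ a<k)

¬HasMax-∷ : ∀ {a k} → k < a → ∀ xs → ¬ HasMax k (a ∷ xs)
¬HasMax-∷ {a} k<a xs a⊔m≡k = <⇒≱ k<a (subst (a ≤_) a⊔m≡k (m≤m⊔n a (maxList xs)))

HasSumMax-∷ : ∀ {a r k} → a < k → a ≤ r → (λ xs → HasSumMax r k (a ∷ xs)) ≐ HasSumMax (r ∸ a) k
HasSumMax-∷ a<k a≤r =
  (λ {xs} (s , m) → proj₁ (HasSum-∷ a≤r) {xs} s , proj₁ (HasMax-∷ a<k) {xs} m) ,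
  (λ {xs} (s , m) → proj₂ (HasSum-∷ a≤r) {xs} s , proj₂ (HasMax-∷ a<k) {xs} m)

-- The condition on the maximum is automatic, since the rest has maximum ≤ sum = d < k.
HasSumMax-∷-max : ∀ {k d} → d < k → (λ xs → HasSumMax (k + d) k (k ∷ xs)) ≐ HasSum d
HasSumMax-∷-max {k} {d} d<k = (λ (k+s≡k+d , _) → +-cancelˡ-≡ k _ _ k+s≡k+d) , λ {xs} → from xs
  where
  from : ∀ xs → sum xs ≡ d → HasSumMax (k + d) k (k ∷ xs)
  from xs refl = refl , m≥n⇒m⊔n≡m (≤-trans (maxList≤sum xs) (<⇒≤ d<k))

comps : (N ℓ r : ℕ) → ℕ
comps N ℓ r = count (hasSum? r) (listsOf N ℓ)

compsMax : (N k ℓ r : ℕ) → ℕ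
compsMax N k ℓ r = count (hasSumMax? r k) (listsOf N ℓ)

∸-suc-< : ∀ {i r} → i < r → r ∸ suc i < r
∸-suc-< i<r = ∸-monoʳ-< z<s i<r

comps-suc : ∀ {N r} ℓ → r ≤ N → comps N (suc ℓ) r ≡ ∑[ i < r ] comps N ℓ (r ∸ suc i)
comps-suc {N} {r} ℓ r≤N = begin
  comps N (suc ℓ) r
    ≡⟨ count-listsOf-suc (hasSum? r) N ℓ ⟩
  ∑[ i < N ] count (λ xs → hasSum? r (suc i ∷ xs)) (listsOf N ℓ)
    ≡⟨ ∑-truncate r≤N (λ r≤i _ → count-none (¬HasSum-∷ (s≤s r≤i)) (listsOf N ℓ)) ⟩
  ∑[ i < r ] count (λ xs → hasSum? r (suc i ∷ xs)) (listsOf N ℓ)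
    ≡⟨ ∑-cong r (λ i<r → count-≐ (HasSum-∷ i<r) (listsOf N ℓ)) ⟩
  ∑[ i < r ] comps N ℓ (r ∸ suc i)
    ∎
  where open ≡-Reasoning

compsMax-suc : ∀ {N k d} ℓ → d < k → k + d ≤ N →
  compsMax N k (suc ℓ) (k + d) ≡ ∑[ i < d ] compsMax N k ℓ (k + (d ∸ suc i)) + comps N ℓ d
compsMax-suc {N} {k@(suc k′)} {d} ℓ d<k@(s≤s d≤k′) k+d≤N = begin
  compsMax N k (suc ℓ) (k + d)
    ≡⟨ count-listsOf-suc (hasSumMax? (k + d) k) N ℓ ⟩
  ∑< N firstPart
    ≡⟨ ∑-truncate (m+n≤o⇒m≤o k k+d≤N) (λ k≤i _ → firstPart-above k≤i) ⟩
  ∑< k firstPart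
    ≡⟨ ∑-suc k′ firstPart ⟩
  ∑< k′ firstPart + firstPart k′
    ≡⟨ cong₂ _+_ (∑-cong k′ firstPart-below) firstPart-max ⟩
  ∑[ i < k′ ] compsMax N k ℓ (k + d ∸ suc i) + comps N ℓ d
    ≡⟨ cong (_+ comps N ℓ d) (∑-truncate d≤k′ (λ d≤i _ → rest-below d≤i)) ⟩
  ∑[ i < d ] compsMax N k ℓ (k + d ∸ suc i) + comps N ℓ d
    ≡⟨ cong (_+ comps N ℓ d) (∑-cong d (λ i<d → cong (compsMax N k ℓ) (+-∸-assoc k i<d))) ⟩
  ∑[ i < d ] compsMax N k ℓ (k + (d ∸ suc i)) + comps N ℓ d
    ∎
  where
  open ≡-Reasoning
  firstPart : ℕ → ℕ
  firstPart i = count (λ xs → hasSumMax? (k + d) k (suc i ∷ xs)) (listsOf N ℓ)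

  firstPart-above : ∀ {i} → k ≤ i → firstPart i ≡ 0
  firstPart-above k≤i = count-none (λ xs → ¬HasMax-∷ (s≤s k≤i) xs ∘ proj₂) (listsOf N ℓ)

  firstPart-below : ∀ {i} → i < k′ → firstPart i ≡ compsMax N k ℓ (k + d ∸ suc i)
  firstPart-below {i} i<k′ = count-≐ (HasSumMax-∷ (s<s i<k′) i<k+d) (listsOf N ℓ)
    where
    i<k+d : i < k + d
    i<k+d = ≤-trans (m≤n⇒m≤1+n i<k′) (m≤m+n k d)

  firstPart-max : firstPart k′ ≡ comps N ℓ d
  firstPart-max = count-≐ (HasSumMax-∷-max d<k) (listsOf N ℓ)

  rest-below : ∀ {i} → d ≤ i → compsMax N k ℓ (k + d ∸ suc i) ≡ 0
  rest-below {i} d≤i = count-none (¬HasSumMax-sum<max k+d∸i<k) (listsOf N ℓ)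
    where
    k+d∸i<k : k + d ∸ suc i < k
    k+d∸i<k = m<n+o⇒m∸n<o (k + d) (suc i) (subst (k + d <_) (+-comm k (suc i)) (+-monoʳ-< k (s≤s d≤i)))

comps< : (N L r : ℕ) → ℕ
comps< N L r = ∑[ ℓ < L ] comps N ℓ r

compsMax< : (N k L d : ℕ) → ℕ
compsMax< N k L d = ∑[ ℓ < L ] compsMax N k ℓ (k + d)

δ₀ : ℕ → ℕ
δ₀ zero    = 1
δ₀ (suc _) = 0

comps<-suc : ∀ {N r} L → r ≤ N → comps< N (suc L) r ≡ δ₀ r + ∑[ i < r ] comps< N L (r ∸ suc i)
comps<-suc {N} {r} L r≤N = cong₂ _+_ (emptyTuple r)
  (trans (∑-cong L (λ {ℓ} _ → comps-suc ℓ r≤N)) (∑-comm L r (λ ℓ i → comps N ℓ (r ∸ suc i))))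
  where
  emptyTuple : ∀ r → comps N 0 r ≡ δ₀ r
  emptyTuple zero    = refl
  emptyTuple (suc r) = refl

compsMax<-suc : ∀ {N k d} L → d < k → k + d ≤ N →
  compsMax< N k (suc L) d ≡ ∑[ i < d ] compsMax< N k L (d ∸ suc i) + comps< N L d
-- With k = suc k′, the term for the empty tuple reduces to 0, as its sum 0 differs from k + d.
compsMax<-suc {N} {suc k′} {d} L d<k k+d≤N = begin
  ∑[ ℓ < L ] compsMax N k (suc ℓ) (k + d)
    ≡⟨ ∑-cong L (λ {ℓ} _ → compsMax-suc ℓ d<k k+d≤N) ⟩
  ∑[ ℓ < L ] (∑[ i < d ] compsMax N k ℓ (k + (d ∸ suc i)) + comps N ℓ d)
    ≡⟨ ∑-distrib-+ L _ _ ⟩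
  ∑[ ℓ < L ] ∑[ i < d ] compsMax N k ℓ (k + (d ∸ suc i)) + comps< N L d
    ≡⟨ cong (_+ comps< N L d) (∑-comm L d (λ ℓ i → compsMax N k ℓ (k + (d ∸ suc i)))) ⟩
  ∑[ i < d ] compsMax< N k L (d ∸ suc i) + comps< N L d
    ∎
  where
  open ≡-Reasoning
  k = suc k′

nCompositions : ℕ → ℕ
nCompositions zero    = 1
nCompositions (suc r) = 2 ^ r

nCompositions-rec : ∀ r → δ₀ r + ∑[ i < r ] nCompositions (r ∸ suc i) ≡ nCompositions r
nCompositions-rec zero    = refl
nCompositions-rec (suc r) = ∑-nCompositions r
  where
  ∑-nCompositions : ∀ r → ∑[ i < suc r ] nCompositions (r ∸ i) ≡ 2 ^ r
  ∑-nCompositions zero    = refl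
  ∑-nCompositions (suc r) = cong (2 ^ r +_) (trans (∑-nCompositions r) (sym (+-identityʳ (2 ^ r))))

comps<-value : ∀ {N r} L → r ≤ N → r < L → comps< N L r ≡ nCompositions r
comps<-value {N} {r} (suc L) r≤N (s≤s r≤L) = begin
  comps< N (suc L) r                                   ≡⟨ comps<-suc L r≤N ⟩
  δ₀ r + ∑[ i < r ] comps< N L (r ∸ suc i)             ≡⟨ cong (δ₀ r +_) (∑-cong r induction) ⟩
  δ₀ r + ∑[ i < r ] nCompositions (r ∸ suc i)          ≡⟨ nCompositions-rec r ⟩
  nCompositions r                                      ∎
  where
  open ≡-Reasoning
  induction : ∀ {i} → i < r → comps< N L (r ∸ suc i) ≡ nCompositions (r ∸ suc i)
  induction {i} i<r = comps<-value L (≤-trans (m∸n≤m r (suc i)) r≤N) (<-≤-trans (∸-suc-< i<r) r≤L)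

-- 4 · B (k + d) k as a function of d < k; the value at d = 0 breaks the pattern (d + 3) · 2 ^ d.
fourB : ℕ → ℕ
fourB zero    = 4
fourB (suc d) = (suc d + 3) * 2 ^ suc d

fourB-rec : ∀ d → ∑[ i < d ] fourB (d ∸ suc i) + 4 * nCompositions d ≡ fourB d
fourB-rec zero    = refl
fourB-rec (suc d) = trans (cong (_+ 4 * 2 ^ d) (∑-fourB d)) (ring d (2 ^ d))
  where
  ring : ∀ d x → (d + 2) * (2 * x) + 4 * x ≡ (suc d + 3) * (2 * x)
  ring = solve-∀
  ∑-fourB : ∀ d → ∑[ i < suc d ] fourB (d ∸ i) ≡ (d + 2) * 2 ^ suc d
  ∑-fourB zero    = refl
  ∑-fourB (suc d) = trans (cong (fourB (suc d) +_) (∑-fourB d)) (ring′ d (2 ^ d))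
    where
    ring′ : ∀ d x → (suc d + 3) * (2 * x) + (d + 2) * (2 * x) ≡ (suc d + 2) * (2 * (2 * x))
    ring′ = solve-∀

compsMax<-value : ∀ {N k d} L → d < k → k + d ≤ N → suc d < L → 4 * compsMax< N k L d ≡ fourB d
compsMax<-value {N} {k} {d} (suc L) d<k k+d≤N (s≤s d<L) = begin
  4 * compsMax< N k (suc L) d
    ≡⟨ cong (4 *_) (compsMax<-suc L d<k k+d≤N) ⟩
  4 * (∑[ i < d ] compsMax< N k L (d ∸ suc i) + comps< N L d)
    ≡⟨ *-distribˡ-+ 4 (∑[ i < d ] compsMax< N k L (d ∸ suc i)) (comps< N L d) ⟩
  4 * ∑[ i < d ] compsMax< N k L (d ∸ suc i) + 4 * comps< N L d
    ≡⟨ cong₂ _+_ (∑-distribˡ-* d 4 _) (cong (4 *_) (comps<-value L (m+n≤o⇒n≤o k k+d≤N) d<L)) ⟩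
  ∑[ i < d ] (4 * compsMax< N k L (d ∸ suc i)) + 4 * nCompositions d
    ≡⟨ cong (_+ 4 * nCompositions d) (∑-cong d induction) ⟩
  ∑[ i < d ] fourB (d ∸ suc i) + 4 * nCompositions d
    ≡⟨ fourB-rec d ⟩
  fourB d
    ∎
  where
  open ≡-Reasoning
  induction : ∀ {i} → i < d → 4 * compsMax< N k L (d ∸ suc i) ≡ fourB (d ∸ suc i)
  induction {i} i<d = compsMax<-value L
    (≤-<-trans (m∸n≤m d (suc i)) d<k)
    (≤-trans (+-monoʳ-≤ k (m∸n≤m d (suc i))) k+d≤N)
    (<-≤-trans (s<s (∸-suc-< i<d)) d<L)

B≡compsMax< : ∀ {n k} → 0 < k → k ≤ n → B n k ≡ compsMax< n k (suc n) (n ∸ k)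
B≡compsMax< {n} {k@(suc _)} _ k≤n = begin
  B n k
    ≡⟨ count-filter (hasMax? k) (candidates n) ⟩
  count (hasSumMax? n k) (candidates n)
    ≡⟨ count-candidates (hasSumMax? n k) n ⟩
  ∑[ ℓ < n ] compsMax n k (suc ℓ) n
    ≡⟨ cong (λ m → ∑[ ℓ < n ] compsMax n k (suc ℓ) m) (m+[n∸m]≡n k≤n) ⟨
  compsMax< n k (suc n) (n ∸ k)
    ∎
  where open ≡-Reasoning

mainTheorem1 : (n k : ℕ) → 1 ≤ k → n < 2 * k → k < n →
    B n k * 4 ≡ (n ∸ k + 3) * 2 ^ (n ∸ k)
mainTheorem1 n k 1≤k n<2k k<n = begin
  B n k * 4                              ≡⟨ *-comm (B n k) 4 ⟩
  4 * B n k                              ≡⟨ cong (4 *_) (B≡compsMax< 1≤k k≤n) ⟩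
  4 * compsMax< n k (suc n) (n ∸ k)      ≡⟨ compsMax<-value (suc n) d<k (≤-reflexive (m+[n∸m]≡n k≤n)) (s<s d<n) ⟩
  fourB (n ∸ k)                          ≡⟨ fourB-positive (m<n⇒0<n∸m k<n) ⟩
  (n ∸ k + 3) * 2 ^ (n ∸ k)              ∎
  where
  open ≡-Reasoning
  k≤n : k ≤ n
  k≤n = <⇒≤ k<n
  d<k : n ∸ k < k
  d<k = m<n+o⇒m∸n<o n k {{>-nonZero 1≤k}} (subst (n <_) (cong (k +_) (+-identityʳ k)) n<2k)
  d<n : n ∸ k < n
  d<n = ∸-monoʳ-< 1≤k k≤n
  fourB-positive : ∀ {d} → 0 < d → fourB d ≡ (d + 3) * 2 ^ d
  fourB-positive {suc d} _ = refl
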